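{- Let $G=(V,E)$ be a finite graph with $n=|V|$ nodes having a perfect matching $M^*$. No $(\rho,x)\in Q$ is produced both by some element of $R_n$ using rule $\mathsf{R}(2)$ and by some element of $R_n$ using rule $\mathsf{R}(5)$.
   Context: Ranking: given a bijection $\sigma:V\to[n]$ (permutation; $\sigma(u)$ is the rank of $u$), list all unordered pairs of distinct nodes lexicographically by $\sigma$ (write each pair $\{a,b\}$ with $\sigma(a)<\sigma(b)$; $\{a_1,b_1\}$ precedes $\{a_2,b_2\}$ iff $\sigma(a_1)<\sigma(a_2)$, or $a_1=a_2$ and $\sigma(b_1)<\sigma(b_2)$), and probe them in this order: when $\{a,b\}$ is probed, if both are unmatched and $\{a,b\}\in E$, match them to each other. The resulting matching is $M(\sigma)$; "matched in $\sigma$", "partner in $\sigma$" refer to $M(\sigma)$. For $u\in V$, $u^*$ denotes the partner of $u$ in the fixed perfect matching $M^*$. $\Omega$ is the set of all permutations. $\sigma_u^i$ is obtained from $\sigma$ by removing $u$ (keeping the relative order of the other nodes) and reinserting $u$ at rank $i$. $Q=\{(\sigma,v):\sigma\in\Omega,\ v\text{ matched in }\sigma\}$; $R_n=\{(\sigma,u):\sigma\in\Omega,\ \sigma(u)=n,\ u\text{ unmatched in }\sigma\}$. Rules: for $(\sigma,u)\in R_n$ and each $i\in[n]$, consider $\sigma_u^i$. If $u$ is unmatched in $\sigma_u^i$: $\mathsf{R}(1)$ produces $(\sigma_u^i,u^*)$; $\mathsf{R}(2)$ produces $(\sigma_u^i,v)$ where $v$ is the partner of $u^*$ in $\sigma_u^i$.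 If $u$ is matched in $\sigma_u^i$: $\mathsf{R}(3)$ produces $(\sigma_u^i,u)$; moreover (a) if $u^*$ is matched to $u$ in $\sigma_u^i$, $\mathsf{R}(4)$ produces $(\sigma_u^i,u^*)$; (b) if $u^*$ is matched to some $v\ne u$ in $\sigma_u^i$, $\mathsf{R}(5)$ produces $(\sigma_u^i,v)$; (c) if $u^*$ is unmatched in $\sigma_u^i$, $\mathsf{R}(6)$ produces $(\sigma_u^i,v_o)$ where $v_o$ is the partner of $u^*$ in $\sigma$. "$(\rho,x)$ is produced using $\mathsf{R}(i)$ by $(\sigma,u)$" means that for some $j\in[n]$, rule $\mathsf{R}(i)$ applies to $\sigma_u^j$ and produces $(\rho,x)$. -}

module Defs where

open import Data.Nat using (ℕ; zero; suc; _∸_)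
open import Data.Fin using (Fin; toℕ; _≟_)
open import Data.Fin.Permutation using (Permutation′; _⟨$⟩ʳ_; _⟨$⟩ˡ_)
open import Data.List using (List; []; _∷_; map; filter; foldl; allFin)
open import Data.Maybe using (Maybe; just; nothing)
open import Data.Product using (Σ; ∃; _×_; _,_)
open import Relation.Nullary using (¬_; yes; no; ¬?)
open import Relation.Binary using (Decidable; Symmetric)
open import Relation.Binary.PropositionalEquality using (_≡_; _≢_)

record Graph (n : ℕ) : Set₁ where
  field
    E      : Fin n → Fin n → Set
    E?     : Decidable E
    E-sym  : Symmetric E
    E-irr  : ∀ u → ¬ E u u

record PerfectMatching {n : ℕ} (G : Graph n) : Set where
  open Graph G
  field
    star       : Fin n → Fin n
    star-invol : ∀ u → star (star u) ≡ u
    star-edge  : ∀ u → E u (star u)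

module Ranking {n : ℕ} (G : Graph n) (M* : PerfectMatching G) where
  open Graph G
  open PerfectMatching M*

  -- partial matching state: mate w = just v iff w is matched to v
  Mate : Set
  Mate = Fin n → Maybe (Fin n)

  probe : Mate → Fin n → Fin n → Mate
  probe m a b with m a | m b | E? a b
  ... | nothing | nothing | yes _ = λ w → upd w (w ≟ a) (w ≟ b)
    where
    upd : (w : Fin n) → _ → _ → Maybe (Fin n)
    upd w (yes _) _ = just b
    upd w (no _) (yes _) = just a
    upd w (no _) (no _) = m w
  ... | _ | _ | _ = m

  -- probe all pairs lexicographically w.r.t. the order of the list
  -- (list = nodes listed by increasing rank)
  run : List (Fin n) → Mate → Mate
  run [] m = m
  run (a ∷ rest) m = run rest (foldl (λ m' b → probe m' a b) m rest)

  mateOf : List (Fin n) → Mate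
  mateOf L = run L (λ _ → nothing)

  -- nodes listed by increasing rank: the node of rank k is σ⁻¹(k)
  order : Permutation′ n → List (Fin n)
  order σ = map (σ ⟨$⟩ˡ_) (allFin n)

  M : Permutation′ n → Mate
  M σ = mateOf (order σ)

  insertAt : ℕ → Fin n → List (Fin n) → List (Fin n)
  insertAt zero x xs = x ∷ xs
  insertAt (suc k) x [] = x ∷ []
  insertAt (suc k) x (y ∷ xs) = y ∷ insertAt k x xs

  -- order list of σ_u^i: remove u, reinsert at (0-based) rank i
  reinsert : Permutation′ n → Fin n → Fin n → List (Fin n)
  reinsert σ u i = insertAt (toℕ i) u (filter (λ w → ¬? (w ≟ u)) (order σ))

  MatchedIn : Permutation′ n → Fin n → Set
  MatchedIn σ v = ∃ λ w → M σ v ≡ just w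

  InQ : Permutation′ n → Fin n → Set
  InQ σ v = MatchedIn σ v

  -- (σ , u) ∈ R_n  (ranks are 0-based here, so rank n is n ∸ 1)
  InRn : Permutation′ n → Fin n → Set
  InRn σ u = (toℕ (σ ⟨$⟩ʳ u) ≡ n ∸ 1) × (M σ u ≡ nothing)

  ProducedR2 : Permutation′ n → Fin n → Permutation′ n → Fin n → Set
  ProducedR2 σ u ρ x = Σ (Fin n) λ j →
    (order ρ ≡ reinsert σ u j) × (M ρ u ≡ nothing) × (M ρ (star u) ≡ just x)

  ProducedR5 : Permutation′ n → Fin n → Permutation′ n → Fin n → Set
  ProducedR5 σ u ρ x = Σ (Fin n) λ j →
    (order ρ ≡ reinsert σ u j) × MatchedIn ρ u × (M ρ (star u) ≡ just x) × (x ≢ u)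

-- Ranking always produces a matching, so x has at most one partner in ρ.
-- Both R(2) and R(5) make x the partner in ρ of u*, resp. u'*; hence u* = u'*
-- and u = u'. But R(2) requires u to be unmatched in ρ, R(5) requires it matched.
module Submission where

open import Defs
open import Data.Nat using (ℕ)
open import Data.Fin using (Fin; _≟_)
open import Data.Fin.Permutation using (Permutation′)
open import Data.List using (List; []; _∷_; foldl)
open import Data.Maybe using (Maybe; just; nothing)
open import Data.Maybe.Properties using (just-injective)
open import Data.Product using (Σ; _×_; _,_)
open import Data.Sum using (_⊎_; inj₁; inj₂)
open import Data.Empty using (⊥-elim)
open import Function using (case_of_)
open import Function.Definitions using (Injective)
open import Function.Consequences.Propositional using (inverseʳ⇒injective; strictlyInverseʳ⇒inverseʳ)
open import Relation.Nullary using (¬_; yes; no)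
open import Relation.Binary.PropositionalEquality

module _ {n : ℕ} where

  Mate : Set
  Mate = Fin n → Maybe (Fin n)

  SymmetricMate : Mate → Set
  SymmetricMate m = ∀ {a b} → m a ≡ just b → m b ≡ just a

  link : Mate → Fin n → Fin n → Mate
  link m a b w with w ≟ a | w ≟ b
  ... | yes _ | _     = just b
  ... | no _  | yes _ = just a
  ... | no _  | no _  = m w

  link-symmetric : ∀ {m a b} → SymmetricMate m → m a ≡ nothing → m b ≡ nothing →
                   a ≢ b → SymmetricMate (link m a b)
  link-symmetric {m} {a} {b} sym-m a-free b-free a≢b {w} {v} w↦v
    with w ≟ a | w ≟ b | w↦v
  ... | yes refl | _ | refl with b ≟ a | b ≟ b
  ...   | yes b≡a | _      = ⊥-elim (a≢b (sym b≡a))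
  ...   | no _    | yes _  = refl
  ...   | no _    | no b≢b = ⊥-elim (b≢b refl)
  link-symmetric {m} {a} {b} sym-m a-free b-free a≢b {w} {v} w↦v
      | no _ | yes refl | refl with a ≟ a
  ...   | yes _  = refl
  ...   | no a≢a = ⊥-elim (a≢a refl)
  link-symmetric {m} {a} {b} sym-m a-free b-free a≢b {w} {v} w↦v
      | no _ | no _ | m-w↦v with v ≟ a | v ≟ b
  ...   | yes refl | _        = case (trans (sym a-free) (sym-m m-w↦v)) of λ ()
  ...   | no _     | yes refl = case (trans (sym b-free) (sym-m m-w↦v)) of λ ()
  ...   | no _     | no _     = sym-m m-w↦v

  symmetricMate-resp-≗ : ∀ {m m′} → m ≗ m′ → SymmetricMate m → SymmetricMate m′
  symmetricMate-resp-≗ m≗m′ sym-m {a} {b} a↦b =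
    trans (sym (m≗m′ b)) (sym-m (trans (m≗m′ a) a↦b))

  symmetricMate-injective : ∀ {m a a′ x} → SymmetricMate m →
                            m a ≡ just x → m a′ ≡ just x → a ≡ a′
  symmetricMate-injective sym-m a↦x a′↦x = just-injective (trans (sym (sym-m a↦x)) (sym-m a′↦x))

module _ {n : ℕ} (G : Graph n) (M* : PerfectMatching G) where
  open Graph G
  open PerfectMatching M*
  open Ranking G M*

  star-injective : Injective _≡_ _≡_ star
  star-injective = inverseʳ⇒injective {f⁻¹ = star} star (strictlyInverseʳ⇒inverseʳ star star-invol)

  probe-link : ∀ {m a b} → m a ≡ nothing → m b ≡ nothing → E a b →
               probe m a b ≗ link m a b
  probe-link {m} {a} {b} a-free b-free ab w rewrite a-free | b-free with E? a b
  ... | no ¬ab = ⊥-elim (¬ab ab)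
  ... | yes _ with w ≟ a | w ≟ b
  ...   | yes _ | _     = refl
  ...   | no _  | yes _ = refl
  ...   | no _  | no _  = refl

  probe-keeps-or-links : ∀ m a b → probe m a b ≗ m ⊎ (m a ≡ nothing × m b ≡ nothing × E a b)
  probe-keeps-or-links m a b with m a | m b | E? a b
  ... | just _  | _       | _      = inj₁ (λ _ → refl)
  ... | nothing | just _  | _      = inj₁ (λ _ → refl)
  ... | nothing | nothing | no _   = inj₁ (λ _ → refl)
  ... | nothing | nothing | yes ab = inj₂ (refl , refl , ab)

  probe-symmetric : ∀ {m} → SymmetricMate m → ∀ a b → SymmetricMate (probe m a b)
  probe-symmetric {m} sym-m a b with probe-keeps-or-links m a b
  ... | inj₁ kept = symmetricMate-resp-≗ (λ w → sym (kept w)) sym-m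
  ... | inj₂ (a-free , b-free , ab) =
    symmetricMate-resp-≗ (λ w → sym (probe-link a-free b-free ab w))
      (link-symmetric sym-m a-free b-free λ { refl → E-irr a ab })

  probeAll-symmetric : ∀ {m} → SymmetricMate m → ∀ a (bs : List (Fin n)) →
                       SymmetricMate (foldl (λ m′ b → probe m′ a b) m bs)
  probeAll-symmetric sym-m a []       = sym-m
  probeAll-symmetric sym-m a (b ∷ bs) = probeAll-symmetric (probe-symmetric sym-m a b) a bs

  run-symmetric : ∀ {m} → SymmetricMate m → ∀ (L : List (Fin n)) → SymmetricMate (run L m)
  run-symmetric sym-m []      = sym-m
  run-symmetric sym-m (a ∷ L) = run-symmetric (probeAll-symmetric sym-m a L) L

  M-symmetric : ∀ σ → SymmetricMate (M σ)
  M-symmetric σ = run-symmetric (λ ()) (order σ)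

lemma6 : (n : ℕ) (G : Graph n) (M* : PerfectMatching G) →
    let open Ranking G M* in
    (ρ : Permutation′ n) (x : Fin n) → InQ ρ x →
    ¬ ((Σ (Permutation′ n) λ σ → Σ (Fin n) λ u → InRn σ u × ProducedR2 σ u ρ x) ×
    (Σ (Permutation′ n) λ σ' → Σ (Fin n) λ u' → InRn σ' u' × ProducedR5 σ' u' ρ x))
lemma6 n G M* ρ x _
  ( (_ , u  , _ , _ , _ , u-free , u*↦x)
  , (_ , u′ , _ , _ , _ , (_ , u′↦v) , u′*↦x , _) )
  with refl ← star-injective G M* (symmetricMate-injective (M-symmetric G M* ρ) u*↦x u′*↦x)
  with () ← trans (sym u-free) u′↦v
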